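{- In the theory Glob, define for each raw context $\Gamma$ the raw substitution $\mathrm{id}_\Gamma$ by $\mathrm{id}_{\mathrm{nil}}=\mathrm{nil}$ and $\mathrm{id}_{\Gamma::(x,A)}=\mathrm{id}_\Gamma::(x,\mathrm{Var}\,x)$. Then for all raw contexts $\Gamma,\Delta$, raw type $A$, raw term $t$ and raw substitution $\gamma$: $A[\mathrm{id}_\Gamma]=A$, $t[\mathrm{id}_\Gamma]=t$, $\gamma\circ\mathrm{id}_\Delta=\gamma$; and if $\Gamma\vdash$ then $\Gamma\vdash\mathrm{id}_\Gamma:\Gamma$.
   Context: Meta-theory: Martin-Löf type theory without axiom K; "$=$" is the identity type. Raw syntax of Glob: raw types $*$ and $\Rightarrow(A,t,u)$; raw terms $\mathrm{Var}\,x$, $x\in\mathbb{N}$; raw contexts are finite lists of pairs $(x,A)$; raw substitutions finite lists of pairs $(x,t)$; $\mathrm{nil}$ empty list, $L::p$ appends $p$. Action of substitutions: $*[\gamma]=*$, $\Rightarrow(A,t,u)[\gamma]=\Rightarrow(A[\gamma],t[\gamma],u[\gamma])$, $\mathrm{Var}\,x[\mathrm{nil}]=\mathrm{Var}\,x$, $\mathrm{Var}\,x[\gamma::(v,t)]=t$ if $x=v$, else $\mathrm{Var}\,x[\gamma]$. Composition: $\mathrm{nil}\circ\delta=\mathrm{nil}$, $(\gamma::(x,t))\circ\delta=(\gamma\circ\delta)::(x,t[\delta])$. Judgements $\Gamma\vdash$, $\Gamma\vdash A$, $\Gamma\vdash t:A$, $\Delta\vdash\gamma:\Gamma$ are inductive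 families generated by: (ec) $\mathrm{nil}\vdash$; (cc) from $\Gamma\vdash$, $\Gamma\vdash A$, $x=\mathrm{length}(\Gamma)$ derive $\Gamma::(x,A)\vdash$; (ob) from $\Gamma\vdash$ derive $\Gamma\vdash *$; (ar) from $\Gamma\vdash t:A$, $\Gamma\vdash u:A$ derive $\Gamma\vdash\Rightarrow(A,t,u)$; (var) from $\Gamma\vdash$ and $(x,A)\in\Gamma$ derive $\Gamma\vdash\mathrm{Var}\,x:A$; (es) from $\Delta\vdash$ derive $\Delta\vdash\mathrm{nil}:\mathrm{nil}$; (sc) from $\Delta\vdash\gamma:\Gamma$, $\Gamma::(x,A)\vdash$, $\Delta\vdash t:A[\gamma]$, $x=y$ derive $\Delta\vdash\gamma::(y,t):\Gamma::(x,A)$. -}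

module Defs where

open import Data.Nat using (ℕ; _≟_)
open import Data.Product using (_×_; _,_)
open import Relation.Nullary using (yes; no)
open import Relation.Binary.PropositionalEquality using (_≡_)

data List (X : Set) : Set where
  nil  : List X
  _::_ : List X → X → List X

infixl 5 _::_

length : ∀ {X} → List X → ℕ
length nil = 0
length (L :: _) = Data.Nat.suc (length L)

data _∈_ {X : Set} (p : X) : List X → Set where
  here  : ∀ {L} → p ∈ (L :: p)
  there : ∀ {L q} → p ∈ L → p ∈ (L :: q)

data Tm : Set where
  Var : ℕ → Tm

data Ty : Set where
  ⋆   : Ty
  ⇒   : Ty → Tm → Tm → Ty

Ctx : Set
Ctx = List (ℕ × Ty)

Sub : Set
Sub = List (ℕ × Tm)

_[_]tm : Tm → Sub → Tm
Var x [ nil ]tm = Var x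
Var x [ γ :: (v , t) ]tm with x ≟ v
... | yes _ = t
... | no _  = Var x [ γ ]tm

_[_]ty : Ty → Sub → Ty
⋆ [ γ ]ty = ⋆
⇒ A t u [ γ ]ty = ⇒ (A [ γ ]ty) (t [ γ ]tm) (u [ γ ]tm)

_∘_ : Sub → Sub → Sub
nil ∘ δ = nil
(γ :: (x , t)) ∘ δ = (γ ∘ δ) :: (x , t [ δ ]tm)

id : Ctx → Sub
id nil = nil
id (Γ :: (x , A)) = id Γ :: (x , Var x)

data _⊢ : Ctx → Set
data _⊢ty_ : Ctx → Ty → Set
data _⊢_∶_ : Ctx → Tm → Ty → Set
data _⊢s_∶_ : Ctx → Sub → Ctx → Set

data _⊢ where
  ec : nil ⊢
  cc : ∀ {Γ A x} → Γ ⊢ → Γ ⊢ty A → x ≡ length Γ → (Γ :: (x , A)) ⊢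

data _⊢ty_ where
  ob : ∀ {Γ} → Γ ⊢ → Γ ⊢ty ⋆
  ar : ∀ {Γ A t u} → Γ ⊢ t ∶ A → Γ ⊢ u ∶ A → Γ ⊢ty ⇒ A t u

data _⊢_∶_ where
  var : ∀ {Γ x A} → Γ ⊢ → (x , A) ∈ Γ → Γ ⊢ Var x ∶ A

data _⊢s_∶_ where
  es : ∀ {Δ} → Δ ⊢ → Δ ⊢s nil ∶ nil
  sc : ∀ {Δ Γ γ x y A t} → Δ ⊢s γ ∶ Γ → (Γ :: (x , A)) ⊢ → Δ ⊢ t ∶ (A [ γ ]ty) → x ≡ y
     → Δ ⊢s (γ :: (y , t)) ∶ (Γ :: (x , A))

{-# OPTIONS --safe #-}
module Submission where

open import Defs
open import Data.Nat using (_≟_)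
open import Data.Product using (_×_; _,_)
open import Relation.Nullary using (yes; no)
open import Relation.Binary.PropositionalEquality using (_≡_; refl; sym; cong; cong₂; subst)

-- id Γ maps each variable of Γ to itself and every other variable falls through
-- to the nil case, so it fixes all raw syntax. Typing id Γ goes by induction on
-- Γ ⊢, and the type A [ id Γ ] demanded of Var x is A by the raw part.

[id]tm : ∀ Γ t → t [ id Γ ]tm ≡ t
[id]tm nil (Var x) = refl
[id]tm (Γ :: (v , _)) (Var x) with x ≟ v
... | yes x≡v = cong Var (sym x≡v)
... | no _    = [id]tm Γ (Var x)

[id]ty : ∀ Γ A → A [ id Γ ]ty ≡ A
[id]ty Γ ⋆         = refl
[id]ty Γ (⇒ A t u) rewrite [id]ty Γ A | [id]tm Γ t | [id]tm Γ u = refl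

∘-identityʳ : ∀ Δ γ → γ ∘ id Δ ≡ γ
∘-identityʳ Δ nil            = refl
∘-identityʳ Δ (γ :: (x , t)) = cong₂ _::_ (∘-identityʳ Δ γ) (cong (x ,_) ([id]tm Δ t))

_⊆_ : Ctx → Ctx → Set
Γ ⊆ Δ = ∀ {p} → p ∈ Γ → p ∈ Δ

-- Generalised to a target Δ ⊇ Γ, since the induction drops the last entry of Γ
-- but not of the context the variables are typed in.
id-⊢s : ∀ {Δ Γ} → Δ ⊢ → Γ ⊢ → Γ ⊆ Δ → Δ ⊢s id Γ ∶ Γ
id-⊢s ⊢Δ ec Γ⊆Δ = es ⊢Δ
id-⊢s {Δ} {Γ :: (x , A)} ⊢Δ ⊢Γ,A@(cc ⊢Γ _ _) Γ,A⊆Δ =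
  sc (id-⊢s ⊢Δ ⊢Γ (λ m → Γ,A⊆Δ (there m))) ⊢Γ,A ⊢x refl
  where
    ⊢x : Δ ⊢ Var x ∶ (A [ id Γ ]ty)
    ⊢x = subst (Δ ⊢ Var x ∶_) (sym ([id]ty Γ A)) (var ⊢Δ (Γ,A⊆Δ here))

mainTheorem3 : (Γ Δ : Ctx) (A : Ty) (t : Tm) (γ : Sub)
    → ((A [ id Γ ]ty) ≡ A)
      × ((t [ id Γ ]tm) ≡ t)
      × ((γ ∘ id Δ) ≡ γ)
      × (Γ ⊢ → Γ ⊢s id Γ ∶ Γ)
mainTheorem3 Γ Δ A t γ =
  [id]ty Γ A , [id]tm Γ t , ∘-identityʳ Δ γ , λ ⊢Γ → id-⊢s ⊢Γ ⊢Γ (λ m → m)
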